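{- Work in CCSK$^{\mathrm{P}}$ as described in the context. For every proof keyed label $\theta$ there exists a process that realises $\theta$, i.e. there exist processes $X, X_1, X_2$ such that there is a path from $X$ to $X_1$ and a combined transition $X_1\xrightarrow{\theta}X_2$.
   Context: Syntax. $\mathsf N$ is an infinite set of names with complement bijection $a\mapsto\overline a$ ($\overline{\overline a}=a$); labels $\mathsf L=\mathsf N\cup\overline{\mathsf N}\cup\{\tau\}$ ranged over by $\alpha$, $\lambda$ ranges over $\mathsf L\setminus\{\tau\}$; $\mathsf K$ is a denumerable set of keys. Processes: $X,Y ::= \mathbf 0 \mid \alpha.X \mid \alpha[k].X \mid X+Y \mid X\mid Y \mid X\setminus a$ ($a\in\mathsf N$ bound in $X$; $\alpha$-equivalent processes identified). $\mathrm{keys}(X)$ is the set of keys occurring in $X$; $\mathrm{std}(X)$ iff $\mathrm{keys}(X)=\emptyset$. Proof keyed labels: $\theta ::= v\,\alpha[k] \mid v\,\langle\theta_L,\theta_R\rangle$ with $v,v_1,v_2$ finite strings over $\{|_L,|_R,+_L,+_R\}$, $\theta_L=v_1\lambda[k]$, $\theta_R=v_2\overline\lambda[k]$ (same key). $\ell(v\alpha[k])=\alpha$, $\ell(v\langle\cdot,\cdot\rangle)=\tau$; $\mathrm{key}(v\alpha[k])=k$, $\mathrm{key}(v\langle v_1\lambda[k],v_2\overline\lambda[k]\rangle)=k$; $s\theta$ denotes prefixing symbol $s$. Forward rules: $\alpha.X\xrightarrow{\alpha[k]}_f\alpha[k].X$ if $\mathrm{std}(X)$; if $X\xrightarrow{\theta}_f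 X'$ and $\mathrm{key}(\theta)\neq k$ then $\alpha[k].X\xrightarrow{\theta}_f\alpha[k].X'$; if $X\xrightarrow{\theta}_f X'$ and $\mathrm{std}(Y)$ then $X+Y\xrightarrow{+_L\theta}_f X'+Y$ (and symmetrically $X+Y\xrightarrow{+_R\theta}_f X+Y'$ when $Y\xrightarrow{\theta}_f Y'$, $\mathrm{std}(X)$); if $X\xrightarrow{\theta}_f X'$ and $\mathrm{key}(\theta)\notin\mathrm{keys}(Y)$ then $X\mid Y\xrightarrow{|_L\theta}_f X'\mid Y$ (symmetrically $|_R$); if $X\xrightarrow{v_1\lambda[k]}_f X'$ and $Y\xrightarrow{v_2\overline\lambda[k]}_f Y'$ then $X\mid Y\xrightarrow{\langle v_1\lambda[k],v_2\overline\lambda[k]\rangle}_f X'\mid Y'$; if $X\xrightarrow{\theta}_f X'$ and $\ell(\theta)\notin\{a,\overline a\}$ then $X\setminus a\xrightarrow{\theta}_f X'\setminus a$. Backward rules are the mirror images of the forward rules (each transition reversed, same side conditions). A combined transition is a forward or backward transition; a path is a finite, possibly empty, sequence of consecutive combined transitions. -}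

module Defs where

open import Data.Nat using (ℕ)
open import Data.List using (List; []; _∷_)
open import Data.Product using (Σ; ∃; _×_; _,_)
open import Data.Sum using (_⊎_)
open import Relation.Nullary using (¬_)
open import Relation.Binary.PropositionalEquality using (_≡_; _≢_)
open import Relation.Binary.Construct.Closure.ReflexiveTransitive using (Star)

Name : Set
Name = ℕ

Key : Set
Key = ℕ

data Act : Set where
  nm  : Name → Act
  co  : Name → Act

bar : Act → Act
bar (nm a) = co a
bar (co a) = nm a

data Label : Set where
  vis : Act → Label
  τ   : Label

data Proc : Set where
  𝟎     : Proc
  _·_   : Label → Proc → Proc
  _[_]·_ : Label → Key → Proc → Proc
  _⊕_   : Proc → Proc → Proc
  _∥_   : Proc → Proc → Proc
  _∖_   : Proc → Name → Proc

infixr 6 _·_ _[_]·_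
infixl 4 _⊕_
infixl 3 _∥_
infixl 5 _∖_

data _∈keys_ (k : Key) : Proc → Set where
  here  : ∀ {α X} → k ∈keys (α [ k ]· X)
  under : ∀ {α k' X} → k ∈keys X → k ∈keys (α [ k' ]· X)
  ⊕ˡ    : ∀ {X Y} → k ∈keys X → k ∈keys (X ⊕ Y)
  ⊕ʳ    : ∀ {X Y} → k ∈keys Y → k ∈keys (X ⊕ Y)
  ∥ˡ    : ∀ {X Y} → k ∈keys X → k ∈keys (X ∥ Y)
  ∥ʳ    : ∀ {X Y} → k ∈keys Y → k ∈keys (X ∥ Y)
  res   : ∀ {X a} → k ∈keys X → k ∈keys (X ∖ a)

std : Proc → Set
std X = ∀ k → ¬ (k ∈keys X)

data Sym : Set where
  |L |R +L +R : Sym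

-- Proof keyed labels:
--   base v α k        is  v α[k]
--   sync v v₁ v₂ λ k  is  v ⟨ v₁ λ[k] , v₂ λ̄[k] ⟩
data PKL : Set where
  base : List Sym → Label → Key → PKL
  sync : List Sym → List Sym → List Sym → Act → Key → PKL

lab : PKL → Label
lab (base _ α _) = α
lab (sync _ _ _ _ _) = τ

key : PKL → Key
key (base _ _ k) = k
key (sync _ _ _ _ k) = k

_▹_ : Sym → PKL → PKL
s ▹ base v α k = base (s ∷ v) α k
s ▹ sync v v₁ v₂ l k = sync (s ∷ v) v₁ v₂ l k

data _—_→f_ : Proc → PKL → Proc → Set where
  act   : ∀ {α X k} → std X → (α · X) — base [] α k →f (α [ k ]· X)
  pre   : ∀ {α k X X' θ} → X — θ →f X' → key θ ≢ k →
          (α [ k ]· X) — θ →f (α [ k ]· X')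
  sumL  : ∀ {X X' Y θ} → X — θ →f X' → std Y → (X ⊕ Y) — +L ▹ θ →f (X' ⊕ Y)
  sumR  : ∀ {X Y Y' θ} → Y — θ →f Y' → std X → (X ⊕ Y) — +R ▹ θ →f (X ⊕ Y')
  parL  : ∀ {X X' Y θ} → X — θ →f X' → ¬ (key θ ∈keys Y) →
          (X ∥ Y) — |L ▹ θ →f (X' ∥ Y)
  parR  : ∀ {X Y Y' θ} → Y — θ →f Y' → ¬ (key θ ∈keys X) →
          (X ∥ Y) — |R ▹ θ →f (X ∥ Y')
  syn   : ∀ {X X' Y Y' v₁ v₂ l k} →
          X — base v₁ (vis l) k →f X' → Y — base v₂ (vis (bar l)) k →f Y' →
          (X ∥ Y) — sync [] v₁ v₂ l k →f (X' ∥ Y')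
  restr : ∀ {X X' a θ} → X — θ →f X' → lab θ ≢ vis (nm a) → lab θ ≢ vis (co a) →
          (X ∖ a) — θ →f (X' ∖ a)

_—_→b_ : Proc → PKL → Proc → Set
X — θ →b X' = X' — θ →f X

_—_→c_ : Proc → PKL → Proc → Set
X — θ →c X' = (X — θ →f X') ⊎ (X — θ →b X')

Step : Proc → Proc → Set
Step X Y = ∃ λ θ → X — θ →c Y

Path : Proc → Proc → Set
Path = Star Step

{-# OPTIONS --safe #-}
module Submission where

open import Defs
open import Data.Product using (Σ; _×_; _,_)
open import Data.List using ([]; _∷_)
open import Data.Sum using (inj₁)
open import Relation.Binary.Construct.Closure.ReflexiveTransitive using (ε)

-- Every label is realised by a forward transition, so the path can be empty.
-- Each symbol of an address is realised by placing the process beside 𝟎 under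
-- the corresponding operator; 𝟎 has no keys, so the side conditions of the sum
-- and parallel rules hold.

Realisable : PKL → Set
Realisable θ = Σ Proc λ X → Σ Proc λ X′ → X — θ →f X′

std-𝟎 : std 𝟎
std-𝟎 _ ()

▹-realisable : ∀ s {θ} → Realisable θ → Realisable (s ▹ θ)
▹-realisable |L (X , X′ , t) = (X ∥ 𝟎) , (X′ ∥ 𝟎) , parL t (std-𝟎 _)
▹-realisable |R (X , X′ , t) = (𝟎 ∥ X) , (𝟎 ∥ X′) , parR t (std-𝟎 _)
▹-realisable +L (X , X′ , t) = (X ⊕ 𝟎) , (X′ ⊕ 𝟎) , sumL t std-𝟎
▹-realisable +R (X , X′ , t) = (𝟎 ⊕ X) , (𝟎 ⊕ X′) , sumR t std-𝟎

base-realisable : ∀ v α k → Realisable (base v α k)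
base-realisable []      α k = α · 𝟎 , α [ k ]· 𝟎 , act std-𝟎
base-realisable (s ∷ v) α k = ▹-realisable s (base-realisable v α k)

syn-realisable : ∀ {v₁ v₂ l k} →
                 Realisable (base v₁ (vis l) k) → Realisable (base v₂ (vis (bar l)) k) →
                 Realisable (sync [] v₁ v₂ l k)
syn-realisable (X , X′ , t) (Y , Y′ , u) = (X ∥ Y) , (X′ ∥ Y′) , syn t u

sync-realisable : ∀ v v₁ v₂ l k → Realisable (sync v v₁ v₂ l k)
sync-realisable []      v₁ v₂ l k =
  syn-realisable (base-realisable v₁ (vis l) k) (base-realisable v₂ (vis (bar l)) k)
sync-realisable (s ∷ v) v₁ v₂ l k = ▹-realisable s (sync-realisable v v₁ v₂ l k)

realisable : ∀ θ → Realisable θ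
realisable (base v α k)       = base-realisable v α k
realisable (sync v v₁ v₂ l k) = sync-realisable v v₁ v₂ l k

lemma3 : (θ : PKL) → Σ Proc λ X → Σ Proc λ X₁ → Σ Proc λ X₂ → Path X X₁ × (X₁ — θ →c X₂)
lemma3 θ with realisable θ
... | X , X′ , t = X , X , X′ , ε , inj₁ t
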